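{- Let $M[P,Q]$ be a lattice path matroid of rank $r$ and nullity $m$ with no isthmuses, with standard presentation $(N_1,\ldots,N_r)$, $N_i=[l_i,g_i]$. Then the maximal presentation of $M[P,Q]$ is $(N'_1,\ldots,N'_r)$ where $N'_i=N_i\cup I_i^+\cup I_i^-$ and $$I_i^+=\{g_i+j : j>0 \text{ and } g_i+j \text{ is the greatest element of } N_{i+j}\},\qquad I_i^-=\{l_i-j : j>0 \text{ and } l_i-j \text{ is the least element of } N_{i-j}\}.$$
   Context: Lattice paths start at $(0,0)$ and use steps $E=(1,0)$ and $N=(0,1)$. For lattice paths $P,Q$ from $(0,0)$ to $(m,r)$ with $P$ never going above $Q$, let $\mathcal{P}$ be the set of lattice paths from $(0,0)$ to $(m,r)$ going neither above $Q$ nor below $P$, and for $1\le i\le r$ let $N_i=\{j:\text{step } j \text{ is the } i\text{ -th North step of some path in }\mathcal{P}\}$; each $N_i$ is an interval $[l_i,g_i]$ of $[m+r]$. $M[P,Q]$ is the transversal matroid on $[m+r]$ with presentation $(N_1,\ldots,N_r)$, its standard presentation. A presentation of a rank-$r$ transversal matroid $M$ is a multiset $(A_1,\ldots,A_r)$ of subsets of $E(M)$ whose maximal partial transversals are the bases of $M$; it is maximal if the only presentation $(A'_1,\ldots,A'_r)$ of $M$ with $A_i\subseteq A'_i$ for all $i$ is $(A_1,\ldots,A_r)$ itself. Every transversal matroid has a unique maximal presentation. -}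

module Defs where

open import Data.Nat using (ℕ; zero; suc; _+_; _≤_; _<_)
open import Data.Fin using (Fin; toℕ)
import Data.Fin as F
open import Data.Fin.Subset using (Subset; _∈_; _∉_; _⊆_)
open import Data.Vec using (Vec; []; _∷_; lookup)
open import Data.Product using (Σ; ∃; ∃-syntax; _×_; _,_)
open import Data.Sum using (_⊎_)
open import Relation.Binary.PropositionalEquality using (_≡_)
open import Relation.Nullary using (¬_)

data Step : Set where
  E N : Step

ht : ∀ {n} → Vec Step n → ℕ → ℕ
ht []       k       = 0
ht (s ∷ v)  zero    = 0
ht (E ∷ v)  (suc k) = ht v k
ht (N ∷ v)  (suc k) = suc (ht v k)

-- A step sequence of length m + r is a lattice path from (0,0) to (m,r)
-- iff it has exactly r North steps.
IsPath : (m r : ℕ) → Vec Step (m + r) → Set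
IsPath m r v = ht v (m + r) ≡ r

-- "P never goes above Q": after every k steps, P has at most as many
-- North steps as Q (both lie on the same anti-diagonal x + y = k).
NotAbove : ∀ {n} → Vec Step n → Vec Step n → Set
NotAbove P Q = ∀ k → ht P k ≤ ht Q k

-- step j (0-indexed position) is the i-th (0-indexed) North step of R
IthNorth : ∀ {n r} → Vec Step n → Fin r → Fin n → Set
IthNorth R i j = lookup R j ≡ N × ht R (toℕ j) ≡ toℕ i

-- The sets N_i of the standard presentation of M[P,Q]
-- (steps/elements indexed by Fin (m + r), i.e. [m+r] shifted by one;
--  North-step indices by Fin r, i.e. [r] shifted by one)
NSet : (m r : ℕ) → Vec Step (m + r) → Vec Step (m + r) →
       Fin r → Fin (m + r) → Set
NSet m r P Q i j =
  ∃[ R ] (IsPath m r R × NotAbove P R × NotAbove R Q × IthNorth R i j)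

Family : ℕ → ℕ → Set₁
Family r n = Fin r → Fin n → Set

toFamily : ∀ {r n} → (Fin r → Subset n) → Family r n
toFamily A i x = x ∈ A i

PartialTransversal : ∀ {r n} → Family r n → Subset n → Set
PartialTransversal {r} {n} A T =
  Σ (Fin n → Fin r) λ φ →
    (∀ x → x ∈ T → A (φ x) x) ×
    (∀ x y → x ∈ T → y ∈ T → φ x ≡ φ y → x ≡ y)

MaxPartialTransversal : ∀ {r n} → Family r n → Subset n → Set
MaxPartialTransversal A T =
  PartialTransversal A T ×
  (∀ T' → PartialTransversal A T' → T ⊆ T' → T' ⊆ T)

StdPres : (m r : ℕ) → Vec Step (m + r) → Vec Step (m + r) → Family r (m + r)
StdPres m r P Q = NSet m r P Q

IsBasis : (m r : ℕ) → Vec Step (m + r) → Vec Step (m + r) → Subset (m + r) → Set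
IsBasis m r P Q B = MaxPartialTransversal (StdPres m r P Q) B

IsIsthmus : (m r : ℕ) → Vec Step (m + r) → Vec Step (m + r) → Fin (m + r) → Set
IsIsthmus m r P Q e = ∀ B → IsBasis m r P Q B → e ∈ B

NoIsthmus : (m r : ℕ) → Vec Step (m + r) → Vec Step (m + r) → Set
NoIsthmus m r P Q = ∀ e → ¬ IsIsthmus m r P Q e

IsPresentation : (m r : ℕ) → Vec Step (m + r) → Vec Step (m + r) →
                 Family r (m + r) → Set
IsPresentation m r P Q A =
  ∀ T → (MaxPartialTransversal A T → IsBasis m r P Q T) ×
        (IsBasis m r P Q T → MaxPartialTransversal A T)

IsMaximalPresentation : (m r : ℕ) → Vec Step (m + r) → Vec Step (m + r) →
                        Family r (m + r) → Set
IsMaximalPresentation m r P Q A =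
  IsPresentation m r P Q A ×
  (∀ (A' : Fin r → Subset (m + r)) →
     IsPresentation m r P Q (toFamily A') →
     (∀ i x → A i x → x ∈ A' i) →
     ∀ i x → x ∈ A' i → A i x)

Greatest : ∀ {n} → (Fin n → Set) → Fin n → Set
Greatest S g = S g × (∀ y → S y → y F.≤ g)

Least : ∀ {n} → (Fin n → Set) → Fin n → Set
Least S l = S l × (∀ y → S y → l F.≤ y)

IPlus : (m r : ℕ) → Vec Step (m + r) → Vec Step (m + r) →
        Fin r → Fin (m + r) → Set
IPlus m r P Q i x =
  ∃[ k ] ∃[ j ] (0 < j × toℕ i + j ≡ toℕ k ×
    ∃[ g ] (Greatest (NSet m r P Q i) g × toℕ x ≡ toℕ g + j ×
            Greatest (NSet m r P Q k) x))

IMinus : (m r : ℕ) → Vec Step (m + r) → Vec Step (m + r) →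
         Fin r → Fin (m + r) → Set
IMinus m r P Q i x =
  ∃[ k ] ∃[ j ] (0 < j × toℕ k + j ≡ toℕ i ×
    ∃[ l ] (Least (NSet m r P Q i) l × toℕ x + j ≡ toℕ l ×
            Least (NSet m r P Q k) x))

N' : (m r : ℕ) → Vec Step (m + r) → Vec Step (m + r) → Family r (m + r)
N' m r P Q i x = NSet m r P Q i x ⊎ IPlus m r P Q i x ⊎ IMinus m r P Q i x

-- A lattice path R is determined by its height function k ↦ ht R k, and the paths between P and Q
-- are exactly the functions with steps 0 or 1 squeezed between hP and hQ. The elements of N′_j
-- sitting between a flat step of P at u and a flat step of Q at k all have j ∈ [hP u, hQ (k+1)),
-- as the extra elements of I⁺_j / I⁻_j lie on straight North runs of P / Q. Hence, by pigeonhole,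
-- the greedy path that climbs at every element of a partial transversal of N′ (and otherwise
-- follows P) never crosses Q: N′ and N have the same partial transversals, so N′ is a
-- presentation. For maximality, let x ∈ A′_i ∖ N′_i for a presentation A′ ⊇ N′. Having no isthmus
-- means hP (x+1) ≤ hQ x, which leaves room for a path that is flat at x yet keeps its i-th North
-- step where P (resp. Q) has it; swapping that step for x yields too many independent elements in
-- a window, again by pigeonhole.

module Submission where

open import Defs
open import Data.Nat using (ℕ; _+_)
open import Data.Vec using (Vec; []; _∷_; lookup; tabulate)
open import Data.Vec.Properties using (lookup∘tabulate; []=⇒lookup; lookup⇒[]=)
open import Data.Nat
  using (zero; suc; _∸_; _≤_; _<_; _≤′_; ≤′-refl; ≤′-step; _⊔_; _⊓_; z≤n; s≤s; s≤s⁻¹; _≟_; _≤?_; _<?_)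
open import Data.Nat.Properties
open import Data.Fin using (Fin; zero; suc; toℕ; fromℕ<)
import Data.Fin as F
open import Data.Fin.Subset using (Subset; _∈_; _⊆_; _∪_; ⁅_⁆)
open import Data.Fin.Subset.Properties using (_∈?_; x∈p∪q⁻; x∈⁅y⁆⇒x≡y; x∈⁅x⁆; p⊆p∪q; x∈p∪q⁺)
open import Data.Fin.Properties using (toℕ-injective; toℕ<n; toℕ-fromℕ<; fromℕ<-toℕ; injective⇒≤)
open import Data.Product using (Σ; ∃-syntax; _×_; _,_; proj₁; proj₂; map)
open import Data.Empty using (⊥; ⊥-elim)
open import Data.Sum using (_⊎_; inj₁; inj₂; [_,_])
open import Function using (_∘_)
open import Function.Definitions using (Injective)
open import Relation.Binary.PropositionalEquality using (_≡_; _≢_; refl; sym; trans; cong; cong₂; subst; module ≡-Reasoning)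
open import Relation.Nullary.Decidable using (dec-true)
open import Relation.Binary.Definitions using (tri<; tri≈; tri>)
open import Relation.Nullary using (¬_; Dec; yes; no; does; ¬?; _×-dec_; contradiction; ¬¬-map; ¬¬-excluded-middle)

∸-split : ∀ {a m b} → a ≤ m → m ≤ b → (b ∸ m) + (m ∸ a) ≡ b ∸ a
∸-split {a} {m} {b} a≤m m≤b = +-cancelʳ-≡ a _ _ (begin
  (b ∸ m) + (m ∸ a) + a   ≡⟨ +-assoc (b ∸ m) (m ∸ a) a ⟩
  (b ∸ m) + ((m ∸ a) + a) ≡⟨ cong ((b ∸ m) +_) (m∸n+n≡m a≤m) ⟩
  (b ∸ m) + m             ≡⟨ m∸n+n≡m m≤b ⟩
  b                       ≡⟨ sym (m∸n+n≡m (≤-trans a≤m m≤b)) ⟩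
  (b ∸ a) + a             ∎)
  where open ≡-Reasoning

FlatAt RiseAt : (ℕ → ℕ) → ℕ → Set
FlatAt f k = f (suc k) ≡ f k
RiseAt f k = f (suc k) ≡ suc (f k)

-- k is the c-th (counting from 0) North step of a path with height function f.
NorthAt : (ℕ → ℕ) → ℕ → ℕ → Set
NorthAt f c k = f k ≡ c × RiseAt f k

UnitIncreasing : (ℕ → ℕ) → Set
UnitIncreasing f = ∀ k → f k ≤ f (suc k) × f (suc k) ≤ suc (f k)

module UnitStep {f : ℕ → ℕ} (f-unit : UnitIncreasing f) where

  step≥ : ∀ k → f k ≤ f (suc k)
  step≥ k = proj₁ (f-unit k)

  step≤ : ∀ k → f (suc k) ≤ suc (f k)
  step≤ k = proj₂ (f-unit k)

  flat⊎rise : ∀ k → FlatAt f k ⊎ RiseAt f k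
  flat⊎rise k with m≤n⇒m<n∨m≡n (step≤ k)
  ... | inj₁ f[k+1]≤f[k] = inj₁ (≤-antisym (s≤s⁻¹ f[k+1]≤f[k]) (step≥ k))
  ... | inj₂ rise        = inj₂ rise

  rise⇒¬flat : ∀ {k} → RiseAt f k → ¬ FlatAt f k
  rise⇒¬flat rise flat = 1+n≢n (trans (sym rise) flat)

  mono : ∀ {a b} → a ≤ b → f a ≤ f b
  mono a≤b = go (≤⇒≤′ a≤b)
    where
    go : ∀ {a b} → a ≤′ b → f a ≤ f b
    go ≤′-refl          = ≤-refl
    go (≤′-step {b} a≤′b) = ≤-trans (go a≤′b) (step≥ b)

  rise-injective : ∀ {a b} → RiseAt f a → RiseAt f b → f a ≡ f b → a ≡ b
  rise-injective {a} {b} rise-a rise-b fa≡fb with <-cmp a b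
  ... | tri≈ _ a≡b _ = a≡b
  ... | tri< a<b _ _ = contradiction (≤-trans (≤-reflexive (sym rise-a)) (mono a<b)) (<-irrefl fa≡fb)
  ... | tri> _ _ b<a = contradiction (≤-trans (≤-reflexive (sym rise-b)) (mono b<a)) (<-irrefl (sym fa≡fb))

  lipschitz : ∀ {a b} → a ≤ b → f b ≤ (b ∸ a) + f a
  lipschitz a≤b = go (≤⇒≤′ a≤b)
    where
    go : ∀ {a b} → a ≤′ b → f b ≤ (b ∸ a) + f a
    go {a} ≤′-refl = ≤-reflexive (cong (_+ f a) (sym (n∸n≡0 a)))
    go {a} (≤′-step {b} a≤′b) = begin
      f (suc b)             ≤⟨ step≤ b ⟩
      suc (f b)             ≤⟨ s≤s (go a≤′b) ⟩
      suc (b ∸ a) + f a     ≡⟨ cong (_+ f a) (sym (+-∸-assoc 1 (≤′⇒≤ a≤′b))) ⟩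
      (suc b ∸ a) + f a     ∎
      where open ≤-Reasoning

  flat⇒lipschitz< : ∀ {a c b} → a ≤ c → c < b → FlatAt f c → suc (f b) ≤ (b ∸ a) + f a
  flat⇒lipschitz< {a} {c} {b} a≤c c<b flat = begin
    suc (f b)                           ≤⟨ s≤s (lipschitz c<b) ⟩
    suc ((b ∸ suc c) + f (suc c))       ≡⟨ cong (λ z → suc ((b ∸ suc c) + z)) flat ⟩
    suc ((b ∸ suc c) + f c)             ≤⟨ s≤s (+-monoʳ-≤ (b ∸ suc c) (lipschitz a≤c)) ⟩
    suc ((b ∸ suc c) + ((c ∸ a) + f a)) ≡⟨ cong suc (sym (+-assoc (b ∸ suc c) (c ∸ a) (f a))) ⟩
    suc ((b ∸ suc c) + (c ∸ a)) + f a   ≡⟨ cong (_+ f a) gap ⟩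
    (b ∸ a) + f a                       ∎
    where
    open ≤-Reasoning
    gap : suc ((b ∸ suc c) + (c ∸ a)) ≡ b ∸ a
    gap = begin-equality
      suc ((b ∸ suc c) + (c ∸ a))   ≡⟨ sym (+-suc (b ∸ suc c) (c ∸ a)) ⟩
      (b ∸ suc c) + suc (c ∸ a)     ≡⟨ cong ((b ∸ suc c) +_) (sym (+-∸-assoc 1 a≤c)) ⟩
      (b ∸ suc c) + (suc c ∸ a)     ≡⟨ ∸-split (m≤n⇒m≤1+n a≤c) c<b ⟩
      b ∸ a                         ∎

  squeeze : ∀ {k c} → f k ≤ c → suc c ≤ f (suc k) → NorthAt f c k
  squeeze {k} {c} fk≤c c<f[k+1] = fk≡c , ≤-antisym (step≤ k) (subst (λ z → suc z ≤ f (suc k)) (sym fk≡c) c<f[k+1])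
    where
    fk≡c : f k ≡ c
    fk≡c = ≤-antisym fk≤c (s≤s⁻¹ (≤-trans c<f[k+1] (step≤ k)))

  crossing : ∀ {u c} K → f u ≤ c → c < f K → ∃[ y ] (u ≤ y × y < K × NorthAt f c y)
  crossing {u} zero    fu≤c c<f0 = contradiction (≤-trans (mono z≤n) fu≤c) (<⇒≱ c<f0)
  crossing {u} {c} (suc K) fu≤c c<fK+1 with c <? f K
  ... | yes c<fK = let y , u≤y , y<K , fy≡c , rise = crossing K fu≤c c<fK
                   in y , u≤y , m≤n⇒m≤1+n y<K , fy≡c , rise
  ... | no  c≮fK = K , u≤K , ≤-refl , squeeze (≮⇒≥ c≮fK) c<fK+1
    where
    u≤K : u ≤ K
    u≤K with u ≤? K
    ... | yes u≤K = u≤K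
    ... | no  u≰K = contradiction (≤-trans (mono (≰⇒> u≰K)) fu≤c) (<⇒≱ c<fK+1)

  enumerate-rises : ∀ {n} u K → u ≤ K → K ≤ n →
          Σ (Fin (f K ∸ f u) → Fin n) λ e → Injective _≡_ _≡_ e ×
            (∀ j → u ≤ toℕ (e j) × toℕ (e j) < K × RiseAt f (toℕ (e j)))
  enumerate-rises {n} u K u≤K K≤n = e , e-injective , e-window
    where
    cross : (j : Fin (f K ∸ f u)) → ∃[ y ] (u ≤ y × y < K × NorthAt f (f u + toℕ j) y)
    cross j = crossing K (m≤m+n (f u) (toℕ j)) level<
      where
      level< : f u + toℕ j < f K
      level< = subst (_≤ f K) (cong suc (+-comm (toℕ j) (f u))) (m≤o∸n⇒m+n≤o (suc (toℕ j)) (mono u≤K) (toℕ<n j))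
    e : Fin (f K ∸ f u) → Fin n
    e j = fromℕ< (<-≤-trans (proj₁ (proj₂ (proj₂ (cross j)))) K≤n)
    toℕ-e : ∀ j → toℕ (e j) ≡ proj₁ (cross j)
    toℕ-e j = toℕ-fromℕ< _
    level : ∀ j → f (toℕ (e j)) ≡ f u + toℕ j
    level j = trans (cong f (toℕ-e j)) (proj₁ (proj₂ (proj₂ (proj₂ (cross j)))))
    e-injective : Injective _≡_ _≡_ e
    e-injective {j} {j′} ej≡ej′ = toℕ-injective (+-cancelˡ-≡ (f u) _ _
      (trans (sym (level j)) (trans (cong (f ∘ toℕ) ej≡ej′) (level j′))))
    e-window : ∀ j → u ≤ toℕ (e j) × toℕ (e j) < K × RiseAt f (toℕ (e j))
    e-window j rewrite toℕ-e j = let _ , u≤y , y<K , _ , rise = cross j in u≤y , y<K , rise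

injective-interval-size : ∀ {D lo hi} (g : Fin D → ℕ) → Injective _≡_ _≡_ g →
                          (∀ j → lo ≤ g j × g j < hi) → D ≤ hi ∸ lo
injective-interval-size {D} {lo} {hi} g g-injective g-in = injective⇒≤ shift-injective
  where
  shift : Fin D → Fin (hi ∸ lo)
  shift j = fromℕ< (∸-monoˡ-< (proj₂ (g-in j)) (proj₁ (g-in j)))
  shift-injective : Injective _≡_ _≡_ shift
  shift-injective {j} {j′} eq = g-injective (∸-cancelʳ-≡ (proj₁ (g-in j)) (proj₁ (g-in j′))
    (trans (sym (toℕ-fromℕ< _)) (trans (cong toℕ eq) (toℕ-fromℕ< _))))

injectiveOn-interval-size : ∀ {n r D lo hi} {B : Subset n} (φ : Fin n → Fin r) →
  (∀ y z → y ∈ B → z ∈ B → φ y ≡ φ z → y ≡ z) →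
  (p : Fin D → Fin n) → Injective _≡_ _≡_ p → (∀ j → p j ∈ B) →
  (∀ j → lo ≤ toℕ (φ (p j)) × toℕ (φ (p j)) < hi) → D ≤ hi ∸ lo
injectiveOn-interval-size φ φ-inj p p-inj p∈B =
  injective-interval-size (toℕ ∘ φ ∘ p) (λ eq → p-inj (φ-inj _ _ (p∈B _) (p∈B _) (toℕ-injective eq)))

⊔-unitIncreasing : ∀ {f g} → UnitIncreasing f → UnitIncreasing g → UnitIncreasing (λ k → f k ⊔ g k)
⊔-unitIncreasing f-unit g-unit k =
  ⊔-mono-≤ (proj₁ (f-unit k)) (proj₁ (g-unit k)) , ⊔-mono-≤ (proj₂ (f-unit k)) (proj₂ (g-unit k))

⊓-unitIncreasing : ∀ {f g} → UnitIncreasing f → UnitIncreasing g → UnitIncreasing (λ k → f k ⊓ g k)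
⊓-unitIncreasing f-unit g-unit k =
  ⊓-mono-≤ (proj₁ (f-unit k)) (proj₁ (g-unit k)) , ⊓-mono-≤ (proj₂ (f-unit k)) (proj₂ (g-unit k))

const-unitIncreasing : ∀ c → UnitIncreasing (λ _ → c)
const-unitIncreasing c k = ≤-refl , n≤1+n c

suc-∸-≤ : ∀ k a → suc k ∸ a ≤ suc (k ∸ a)
suc-∸-≤ k       zero    = ≤-refl
suc-∸-≤ zero    (suc a) = ≤-trans (≤-reflexive (0∸n≡0 a)) z≤n
suc-∸-≤ (suc k) (suc a) = suc-∸-≤ k a

-- Height c up to a, then slope one: truncated subtraction makes it flat on the left.
line : ℕ → ℕ → ℕ → ℕ
line c a k = c + (k ∸ a)

line-unitIncreasing : ∀ c a → UnitIncreasing (line c a)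
line-unitIncreasing c a k =
  +-monoʳ-≤ c (∸-monoˡ-≤ a (n≤1+n k)) ,
  ≤-trans (+-monoʳ-≤ c (suc-∸-≤ k a)) (≤-reflexive (+-suc c (k ∸ a)))

line-start : ∀ c a → line c a a ≡ c
line-start c a = trans (cong (c +_) (n∸n≡0 a)) (+-identityʳ c)

line-rises : ∀ c a {k} → a ≤ k → RiseAt (line c a) k
line-rises c a {k} a≤k = trans (cong (c +_) (+-∸-assoc 1 a≤k)) (+-suc c (k ∸ a))

ht-zero : ∀ {n} (v : Vec Step n) → ht v 0 ≡ 0
ht-zero []      = refl
ht-zero (_ ∷ _) = refl

ht-unitIncreasing : ∀ {n} (v : Vec Step n) → UnitIncreasing (ht v)
ht-unitIncreasing []      k       = ≤-refl , z≤n
ht-unitIncreasing (E ∷ v) zero    = z≤n , ≤-trans (≤-reflexive (ht-zero v)) z≤n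
ht-unitIncreasing (N ∷ v) zero    = z≤n , s≤s (≤-trans (≤-reflexive (ht-zero v)) z≤n)
ht-unitIncreasing (E ∷ v) (suc k) = ht-unitIncreasing v k
ht-unitIncreasing (N ∷ v) (suc k) = map s≤s s≤s (ht-unitIncreasing v k)

north⇒rise : ∀ {n} (v : Vec Step n) j → lookup v j ≡ N → RiseAt (ht v) (toℕ j)
north⇒rise (N ∷ v) zero    _  = cong suc (ht-zero v)
north⇒rise (E ∷ v) (suc j) eq = north⇒rise v j eq
north⇒rise (N ∷ v) (suc j) eq = cong suc (north⇒rise v j eq)

east⇒flat : ∀ {n} (v : Vec Step n) j → lookup v j ≡ E → FlatAt (ht v) (toℕ j)
east⇒flat (E ∷ v) zero    _  = ht-zero v
east⇒flat (E ∷ v) (suc j) eq = east⇒flat v j eq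
east⇒flat (N ∷ v) (suc j) eq = cong suc (east⇒flat v j eq)

rise⇒north : ∀ {n} (v : Vec Step n) j → RiseAt (ht v) (toℕ j) → lookup v j ≡ N
rise⇒north v j rise with lookup v j in step
... | N = refl
... | E = contradiction (east⇒flat v j step) (UnitStep.rise⇒¬flat (ht-unitIncreasing v) rise)

ht-beyond : ∀ {n} (v : Vec Step n) {k} → n ≤ k → ht v k ≡ ht v n
ht-beyond []      _         = refl
ht-beyond (E ∷ v) (s≤s n≤k) = ht-beyond v n≤k
ht-beyond (N ∷ v) (s≤s n≤k) = cong suc (ht-beyond v n≤k)

stepBetween : ℕ → ℕ → Step
stepBetween a b with b ≟ suc a
... | yes _ = N
... | no  _ = E

fromHeights : (n : ℕ) → (ℕ → ℕ) → Vec Step n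
fromHeights zero    h = []
fromHeights (suc n) h = stepBetween (h 0) (h 1) ∷ fromHeights n (h ∘ suc)

ht-fromHeights : ∀ {h} → UnitIncreasing h → ∀ {n k} → k ≤ n → ht (fromHeights n h) k + h 0 ≡ h k
ht-fromHeights {h} h-unit {n} {zero} _ = cong (_+ h 0) (ht-zero (fromHeights n h))
ht-fromHeights {h} h-unit {suc n} {suc k} (s≤s k≤n)
  with h 1 ≟ suc (h 0) | UnitStep.flat⊎rise h-unit 0
... | yes rise | _ = begin
  suc (ht rest k) + h 0   ≡⟨ sym (+-suc (ht rest k) (h 0)) ⟩
  ht rest k + suc (h 0)   ≡⟨ cong (ht rest k +_) (sym rise) ⟩
  ht rest k + h 1         ≡⟨ ht-fromHeights (h-unit ∘ suc) k≤n ⟩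
  h (suc k)               ∎
  where
  open ≡-Reasoning
  rest = fromHeights n (h ∘ suc)
... | no ¬rise | inj₁ flat = trans (cong (ht rest k +_) (sym flat)) (ht-fromHeights (h-unit ∘ suc) k≤n)
  where rest = fromHeights n (h ∘ suc)
... | no ¬rise | inj₂ rise = contradiction rise ¬rise

select : ∀ {n} {Pr : Fin n → Set} → (∀ x → Dec (Pr x)) → Subset n
select Pr? = tabulate (does ∘ Pr?)

∈-select⁺ : ∀ {n} {Pr : Fin n → Set} (Pr? : ∀ x → Dec (Pr x)) {x} → Pr x → x ∈ select Pr?
∈-select⁺ Pr? {x} px = lookup⇒[]= x _ (trans (lookup∘tabulate (does ∘ Pr?) x) (dec-true (Pr? x) px))

∈-select⁻ : ∀ {n} {Pr : Fin n → Set} (Pr? : ∀ x → Dec (Pr x)) {x} → x ∈ select Pr? → Pr x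
∈-select⁻ Pr? {x} x∈ with Pr? x | trans (sym (lookup∘tabulate (does ∘ Pr?) x)) ([]=⇒lookup x∈)
... | yes px | _ = px
... | no  _  | ()

north? : (s : Step) → Dec (s ≡ N)
north? N = yes refl
north? E = no λ ()

module Transversals {r n} (A : Family r n) where

  partialTransversal-mono : ∀ (A′ : Family r n) → (∀ i x → A i x → A′ i x) →
                            ∀ {T} → PartialTransversal A T → PartialTransversal A′ T
  partialTransversal-mono A′ A⊆A′ (φ , φ∈ , φ-inj) = φ , (λ x x∈T → A⊆A′ _ x (φ∈ x x∈T)) , φ-inj

  maxPartialTransversal-transfer : ∀ (A′ : Family r n) →
    (∀ T → PartialTransversal A T → PartialTransversal A′ T) →
    (∀ T → PartialTransversal A′ T → PartialTransversal A T) →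
    ∀ {T} → MaxPartialTransversal A T → MaxPartialTransversal A′ T
  maxPartialTransversal-transfer A′ to from (pt , maximal) =
    to _ pt , λ T′ pt′ T⊆T′ → maximal T′ (from T′ pt′) T⊆T′

  ∪⁅⁆-partialTransversal : ∀ {T s x} (φ : Fin n → Fin r) →
    (∀ y → y ∈ T → A (φ y) y) → (∀ y z → y ∈ T → z ∈ T → φ y ≡ φ z → y ≡ z) →
    A s x → (∀ y → y ∈ T → φ y ≡ s → y ≡ x) → PartialTransversal A (T ∪ ⁅ x ⁆)
  ∪⁅⁆-partialTransversal {T} {s} {x} φ φ∈ φ-inj x∈As only-x = φ′ , φ′∈ , φ′-inj
    where
    φ′ : Fin n → Fin r
    φ′ y with y F.≟ x
    ... | yes _ = s
    ... | no  _ = φ y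
    old : ∀ {y} → y ∈ T ∪ ⁅ x ⁆ → y ≢ x → y ∈ T
    old {y} y∈ y≢x with x∈p∪q⁻ T ⁅ x ⁆ y∈
    ... | inj₁ y∈T = y∈T
    ... | inj₂ y∈⁅x⁆ = contradiction (x∈⁅y⁆⇒x≡y x y∈⁅x⁆) y≢x
    φ′∈ : ∀ y → y ∈ T ∪ ⁅ x ⁆ → A (φ′ y) y
    φ′∈ y y∈ with y F.≟ x
    ... | yes refl = x∈As
    ... | no  y≢x  = φ∈ y (old y∈ y≢x)
    φ′-inj : ∀ y z → y ∈ T ∪ ⁅ x ⁆ → z ∈ T ∪ ⁅ x ⁆ → φ′ y ≡ φ′ z → y ≡ z
    φ′-inj y z y∈ z∈ eq with y F.≟ x | z F.≟ x
    ... | yes y≡x | yes z≡x = trans y≡x (sym z≡x)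
    ... | yes y≡x | no  z≢x = trans y≡x (sym (only-x z (old z∈ z≢x) (sym eq)))
    ... | no  y≢x | yes z≡x = trans (only-x y (old y∈ y≢x) eq) (sym z≡x)
    ... | no  y≢x | no  z≢x = φ-inj y z (old y∈ y≢x) (old z∈ z≢x) eq

  private
    Saturated : ℕ → Subset n → Set
    Saturated k B = ∀ y → toℕ y < k → ∀ T → PartialTransversal A T → B ⊆ T → y ∈ T → y ∈ B

    ¬¬-saturatedExtension : ∀ {T} → PartialTransversal A T → ∀ k → k ≤ n →
      ¬ ¬ (∃[ B ] (PartialTransversal A B × T ⊆ B × Saturated k B))
    ¬¬-saturatedExtension {T} pt zero _ ¬ext = ¬ext (T , pt , (λ x∈T → x∈T) , λ _ ())
    ¬¬-saturatedExtension {T} pt (suc k) k<n ¬ext =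
      ¬¬-saturatedExtension pt k (<⇒≤ k<n) λ (B , ptB , T⊆B , sat) →
        ¬¬-excluded-middle λ addable? → ¬ext (saturate B ptB T⊆B sat addable?)
      where
      y = fromℕ< k<n
      at-k : ∀ z → toℕ z < suc k → toℕ z < k ⊎ z ≡ y
      at-k z z<k+1 with m≤n⇒m<n∨m≡n (s≤s⁻¹ z<k+1)
      ... | inj₁ z<k = inj₁ z<k
      ... | inj₂ z≡k = inj₂ (toℕ-injective (trans z≡k (sym (toℕ-fromℕ< k<n))))
      saturate : ∀ B → PartialTransversal A B → T ⊆ B → Saturated k B →
                 Dec (∃[ B′ ] (PartialTransversal A B′ × B ⊆ B′ × y ∈ B′)) →
                 ∃[ B ] (PartialTransversal A B × T ⊆ B × Saturated (suc k) B)
      saturate B ptB T⊆B sat (yes (B′ , ptB′ , B⊆B′ , y∈B′)) =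
        B′ , ptB′ , (λ x∈T → B⊆B′ (T⊆B x∈T)) , sat′
        where
        sat′ : Saturated (suc k) B′
        sat′ z z<k+1 T′ ptT′ B′⊆T′ z∈T′ with at-k z z<k+1
        ... | inj₁ z<k  = B⊆B′ (sat z z<k T′ ptT′ (λ x∈B → B′⊆T′ (B⊆B′ x∈B)) z∈T′)
        ... | inj₂ refl = y∈B′
      saturate B ptB T⊆B sat (no unaddable) = B , ptB , T⊆B , sat′
        where
        sat′ : Saturated (suc k) B
        sat′ z z<k+1 T′ ptT′ B⊆T′ z∈T′ with at-k z z<k+1
        ... | inj₁ z<k  = sat z z<k T′ ptT′ B⊆T′ z∈T′
        ... | inj₂ refl = contradiction (T′ , ptT′ , (λ {x} → B⊆T′ {x}) , z∈T′) unaddable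

  ¬¬-maximalExtension : ∀ {T} → PartialTransversal A T →
                        ¬ ¬ (∃[ B ] (MaxPartialTransversal A B × T ⊆ B))
  ¬¬-maximalExtension {T} pt = ¬¬-map maximal (¬¬-saturatedExtension pt n ≤-refl)
    where
    maximal : ∃[ B ] (PartialTransversal A B × T ⊆ B × Saturated n B) →
              ∃[ B ] (MaxPartialTransversal A B × T ⊆ B)
    maximal (B , ptB , T⊆B , sat) =
      B , (ptB , λ T′ ptT′ B⊆T′ {y} → sat y (toℕ<n y) T′ ptT′ B⊆T′) , T⊆B

module LatticePathMatroid (m r : ℕ) (P Q : Vec Step (m + r))
         (P-path : IsPath m r P) (Q-path : IsPath m r Q) (P≤Q : NotAbove P Q) where

  n : ℕ
  n = m + r

  hP hQ : ℕ → ℕ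
  hP = ht P
  hQ = ht Q

  module P = UnitStep (ht-unitIncreasing P)
  module Q = UnitStep (ht-unitIncreasing Q)

  Between : Vec Step n → Set
  Between R = IsPath m r R × NotAbove P R × NotAbove R Q

  path-ht-beyond : ∀ R → IsPath m r R → ∀ {k} → n ≤ k → ht R k ≡ r
  path-ht-beyond R R-path n≤k = trans (ht-beyond R n≤k) R-path

  path-ht≤r : ∀ R → IsPath m r R → ∀ k → ht R k ≤ r
  path-ht≤r R R-path k with k ≤? n
  ... | yes k≤n = ≤-trans (UnitStep.mono (ht-unitIncreasing R) k≤n) (≤-reflexive R-path)
  ... | no  k≰n = ≤-reflexive (path-ht-beyond R R-path (<⇒≤ (≰⇒> k≰n)))

  path-from-heights : ∀ {h} → UnitIncreasing h → (∀ k → k ≤ n → hP k ≤ h k × h k ≤ hQ k) →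
                      Σ (Vec Step n) λ R → Between R × (∀ k → k ≤ n → ht R k ≡ h k)
  path-from-heights {h} h-unit bounds = R , (R-path , P≤R , R≤Q) , ht-R
    where
    R = fromHeights n h
    h0≡0 : h 0 ≡ 0
    h0≡0 = n≤0⇒n≡0 (≤-trans (proj₂ (bounds 0 z≤n)) (≤-reflexive (ht-zero Q)))
    ht-R : ∀ k → k ≤ n → ht R k ≡ h k
    ht-R k k≤n = trans (sym (trans (cong (ht R k +_) h0≡0) (+-identityʳ _))) (ht-fromHeights h-unit k≤n)
    R-path : IsPath m r R
    R-path = trans (ht-R n ≤-refl) (≤-antisym (≤-trans (proj₂ (bounds n ≤-refl)) (≤-reflexive Q-path))
                                              (≤-trans (≤-reflexive (sym P-path)) (proj₁ (bounds n ≤-refl))))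
    P≤R : NotAbove P R
    P≤R k with k ≤? n
    ... | yes k≤n = subst (hP k ≤_) (sym (ht-R k k≤n)) (proj₁ (bounds k k≤n))
    ... | no  k≰n = ≤-reflexive (trans (path-ht-beyond P P-path n≤k) (sym (path-ht-beyond R R-path n≤k)))
      where n≤k = <⇒≤ (≰⇒> k≰n)
    R≤Q : NotAbove R Q
    R≤Q k with k ≤? n
    ... | yes k≤n = subst (_≤ hQ k) (sym (ht-R k k≤n)) (proj₂ (bounds k k≤n))
    ... | no  k≰n = ≤-reflexive (trans (path-ht-beyond R R-path n≤k) (sym (path-ht-beyond Q Q-path n≤k)))
      where n≤k = <⇒≤ (≰⇒> k≰n)

  clamp : (ℕ → ℕ) → ℕ → ℕ
  clamp D k = hP k ⊔ (hQ k ⊓ D k)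

  clamp-path : ∀ {D} → UnitIncreasing D → Σ (Vec Step n) λ R → Between R × (∀ k → k ≤ n → ht R k ≡ clamp D k)
  clamp-path D-unit = path-from-heights
    (⊔-unitIncreasing (ht-unitIncreasing P) (⊓-unitIncreasing (ht-unitIncreasing Q) D-unit))
    (λ k _ → m≤m⊔n _ _ , ⊔-lub (P≤Q k) (m⊓n≤m _ _))

  clamp-fixes : ∀ D {k c} → D k ≡ c → hP k ≤ c → c ≤ hQ k → clamp D k ≡ c
  clamp-fixes D {k} refl hP≤c c≤hQ = trans (cong (hP k ⊔_) (m≥n⇒m⊓n≡n c≤hQ)) (m≤n⇒m⊔n≡n hP≤c)

  clamp-below : ∀ D {k} → D k ≤ hP k → clamp D k ≡ hP k
  clamp-below D D≤hP = m≥n⇒m⊔n≡m (≤-trans (m⊓n≤n _ _) D≤hP)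

  clamp-above : ∀ D {k} → hQ k ≤ D k → clamp D k ≡ hQ k
  clamp-above D {k} hQ≤D = trans (cong (hP k ⊔_) (m≤n⇒m⊓n≡m hQ≤D)) (m≤n⇒m⊔n≡n (P≤Q k))

  between-north⇒nset : ∀ R {i j} → Between R → lookup R j ≡ N → ht R (toℕ j) ≡ toℕ i → NSet m r P Q i j
  between-north⇒nset R (R-path , P≤R , R≤Q) north ht≡i = R , R-path , P≤R , R≤Q , north , ht≡i

  nset⇒band : ∀ {i j} → NSet m r P Q i j → hP (toℕ j) ≤ toℕ i × toℕ i < hQ (suc (toℕ j))
  nset⇒band {i} {j} (R , _ , P≤R , R≤Q , north , ht≡i) =
    subst (hP (toℕ j) ≤_) ht≡i (P≤R (toℕ j)) ,
    subst (_≤ hQ (suc (toℕ j))) (trans (north⇒rise R j north) (cong suc ht≡i)) (R≤Q (suc (toℕ j)))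

  band⇒nset : ∀ {i j} → hP (toℕ j) ≤ toℕ i → toℕ i < hQ (suc (toℕ j)) → NSet m r P Q i j
  band⇒nset {i} {j} hP≤i i<hQ =
    between-north⇒nset R R-between (rise⇒north R j (trans ht-J+1 (cong suc (sym ht-J)))) ht-J
    where
    I = toℕ i
    J = toℕ j
    path = clamp-path (line-unitIncreasing I J)
    R = proj₁ path
    R-between = proj₁ (proj₂ path)
    ht-J : ht R J ≡ I
    ht-J = trans (proj₂ (proj₂ path) J (<⇒≤ (toℕ<n j)))
                 (clamp-fixes (line I J) (line-start I J) hP≤i (s≤s⁻¹ (<-≤-trans i<hQ (Q.step≤ J))))
    ht-J+1 : ht R (suc J) ≡ suc I
    ht-J+1 = trans (proj₂ (proj₂ path) (suc J) (toℕ<n j))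
                   (clamp-fixes (line I J) (trans (line-rises I J ≤-refl) (cong suc (line-start I J)))
                                (≤-trans (P.step≤ J) (s≤s hP≤i)) i<hQ)

  -- Index maps must be total on Fin n; the fallback is never used at a North step.
  heightIndex : Vec Step n → (Fin n → Fin r) → Fin n → Fin r
  heightIndex R fallback x with ht R (toℕ x) <? r
  ... | yes ht<r = fromℕ< ht<r
  ... | no  _    = fallback x

  toℕ-heightIndex : ∀ R → IsPath m r R → ∀ fallback x → lookup R x ≡ N →
                    toℕ (heightIndex R fallback x) ≡ ht R (toℕ x)
  toℕ-heightIndex R R-path fallback x north with ht R (toℕ x) <? r
  ... | yes ht<r = toℕ-fromℕ< ht<r
  ... | no  ht≮r = contradiction ht<r ht≮r
    where
    ht<r : ht R (toℕ x) < r
    ht<r = subst (_≤ r) (north⇒rise R x north) (path-ht≤r R R-path (suc (toℕ x)))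

  heightIndex-nset : ∀ R → Between R → ∀ fallback x → lookup R x ≡ N → NSet m r P Q (heightIndex R fallback x) x
  heightIndex-nset R R-between fallback x north =
    between-north⇒nset R R-between north (sym (toℕ-heightIndex R (proj₁ R-between) fallback x north))

  heightIndex-injective : ∀ R → IsPath m r R → ∀ fallback x y → lookup R x ≡ N → lookup R y ≡ N →
                          heightIndex R fallback x ≡ heightIndex R fallback y → x ≡ y
  heightIndex-injective R R-path fallback x y north-x north-y eq =
    toℕ-injective (UnitStep.rise-injective (ht-unitIncreasing R) (north⇒rise R x north-x) (north⇒rise R y north-y)
      (trans (sym (toℕ-heightIndex R R-path fallback x north-x))
             (trans (cong toℕ eq) (toℕ-heightIndex R R-path fallback y north-y))))

  northSteps-partialTransversal : ∀ R → Between R → (fallback : Fin n → Fin r) → ∀ T →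
                                  (∀ x → x ∈ T → lookup R x ≡ N) → PartialTransversal (NSet m r P Q) T
  northSteps-partialTransversal R R-between fallback T north =
    heightIndex R fallback ,
    (λ x x∈T → heightIndex-nset R R-between fallback x (north x x∈T)) ,
    (λ x y x∈T y∈T → heightIndex-injective R (proj₁ R-between) fallback x y (north x x∈T) (north y y∈T))

  northAt-exists : ∀ R → IsPath m r R → (i : Fin r) → ∃[ g ] (g < n × NorthAt (ht R) (toℕ i) g)
  northAt-exists R R-path i =
    let _ , _ , g<n , north = UnitStep.crossing (ht-unitIncreasing R) {u = 0} n
                                (≤-trans (≤-reflexive (ht-zero R)) z≤n) (subst (toℕ i <_) (sym R-path) (toℕ<n i))
    in _ , g<n , north

  northAtP⇒greatest : ∀ {i g} → NorthAt hP (toℕ i) (toℕ g) → Greatest (NSet m r P Q i) g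
  northAtP⇒greatest {i} {g} (hPg≡i , rise) =
    band⇒nset (≤-reflexive hPg≡i) (≤-trans (≤-reflexive (sym hP[g+1]≡i+1)) (P≤Q _)) , below
    where
    hP[g+1]≡i+1 : hP (suc (toℕ g)) ≡ suc (toℕ i)
    hP[g+1]≡i+1 = trans rise (cong suc hPg≡i)
    below : ∀ y → NSet m r P Q i y → y F.≤ g
    below y y∈N with toℕ y ≤? toℕ g
    ... | yes y≤g = y≤g
    ... | no  y≰g = contradiction
      (≤-trans (≤-reflexive (sym hP[g+1]≡i+1)) (≤-trans (P.mono (≰⇒> y≰g)) (proj₁ (nset⇒band y∈N))))
      (<-irrefl refl)

  greatest⇒northAtP : ∀ {i g} → Greatest (NSet m r P Q i) g → NorthAt hP (toℕ i) (toℕ g)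
  greatest⇒northAtP {i} {g} (g∈N , below) =
    P.squeeze (proj₁ (nset⇒band g∈N))
              (≤-trans (≤-reflexive (sym (trans rise (cong suc hPg′≡i)))) (P.mono (s≤s g′≤g)))
    where
    g′-north = northAt-exists P P-path i
    g′ = fromℕ< (proj₁ (proj₂ g′-north))
    toℕ-g′ : toℕ g′ ≡ proj₁ g′-north
    toℕ-g′ = toℕ-fromℕ< _
    hPg′≡i : hP (proj₁ g′-north) ≡ toℕ i
    hPg′≡i = proj₁ (proj₂ (proj₂ g′-north))
    rise = proj₂ (proj₂ (proj₂ g′-north))
    g′≤g : proj₁ g′-north ≤ toℕ g
    g′≤g = subst (_≤ toℕ g) toℕ-g′
             (below g′ (proj₁ (northAtP⇒greatest (subst (NorthAt hP (toℕ i)) (sym toℕ-g′) (hPg′≡i , rise)))))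

  northAtQ⇒least : ∀ {i l} → NorthAt hQ (toℕ i) (toℕ l) → Least (NSet m r P Q i) l
  northAtQ⇒least {i} {l} (hQl≡i , rise) =
    band⇒nset (≤-trans (P≤Q _) (≤-reflexive hQl≡i)) (≤-reflexive (sym (trans rise (cong suc hQl≡i)))) , above
    where
    above : ∀ y → NSet m r P Q i y → l F.≤ y
    above y y∈N with toℕ l ≤? toℕ y
    ... | yes l≤y = l≤y
    ... | no  l≰y = contradiction
      (≤-trans (proj₂ (nset⇒band y∈N)) (≤-trans (Q.mono (≰⇒> l≰y)) (≤-reflexive hQl≡i)))
      (<-irrefl refl)

  least⇒northAtQ : ∀ {i l} → Least (NSet m r P Q i) l → NorthAt hQ (toℕ i) (toℕ l)
  least⇒northAtQ {i} {l} (l∈N , above) =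
    Q.squeeze (≤-trans (Q.mono l≤l′) (≤-reflexive hQl′≡i)) (proj₂ (nset⇒band l∈N))
    where
    l′-north = northAt-exists Q Q-path i
    l′ = fromℕ< (proj₁ (proj₂ l′-north))
    toℕ-l′ : toℕ l′ ≡ proj₁ l′-north
    toℕ-l′ = toℕ-fromℕ< _
    hQl′≡i : hQ (proj₁ l′-north) ≡ toℕ i
    hQl′≡i = proj₁ (proj₂ (proj₂ l′-north))
    rise = proj₂ (proj₂ (proj₂ l′-north))
    l≤l′ : toℕ l ≤ proj₁ l′-north
    l≤l′ = subst (toℕ l ≤_) toℕ-l′
             (above l′ (proj₁ (northAtQ⇒least (subst (NorthAt hQ (toℕ i)) (sym toℕ-l′) (hQl′≡i , rise)))))

  -- x is then the only element of N_s for s = hQ x, so every basis must contain it.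
  pinched⇒isthmus : ∀ x → hQ (toℕ x) < hP (suc (toℕ x)) → IsIsthmus m r P Q x
  pinched⇒isthmus x pinched B ((φ , φ∈ , φ-inj) , maximal) =
    maximal (B ∪ ⁅ x ⁆) extended (p⊆p∪q ⁅ x ⁆) (x∈p∪q⁺ (inj₂ (x∈⁅x⁆ x)))
    where
    X = toℕ x
    s<r : hQ X < r
    s<r = <-≤-trans pinched (path-ht≤r P P-path _)
    s = fromℕ< s<r
    toℕ-s : toℕ s ≡ hQ X
    toℕ-s = toℕ-fromℕ< s<r
    x∈Ns : NSet m r P Q s x
    x∈Ns = band⇒nset (≤-trans (P≤Q X) (≤-reflexive (sym toℕ-s)))
                     (subst (_< hQ (suc X)) (sym toℕ-s) (<-≤-trans pinched (P≤Q (suc X))))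
    only-x : ∀ y → NSet m r P Q s y → y ≡ x
    only-x y y∈Ns with nset⇒band y∈Ns | <-cmp (toℕ y) X
    ... | _ , _        | tri≈ _ y≡x _ = toℕ-injective y≡x
    ... | _ , s<hQ[y+1] | tri< y<x _ _ =
      contradiction (≤-trans s<hQ[y+1] (≤-trans (Q.mono y<x) (≤-reflexive (sym toℕ-s)))) (<-irrefl refl)
    ... | hPy≤s , _    | tri> _ _ x<y =
      contradiction (≤-trans pinched (≤-trans (P.mono x<y) (≤-trans hPy≤s (≤-reflexive toℕ-s)))) (<-irrefl refl)
    extended : PartialTransversal (NSet m r P Q) (B ∪ ⁅ x ⁆)
    extended = Transversals.∪⁅⁆-partialTransversal (NSet m r P Q) φ φ∈ φ-inj x∈Ns
                 (λ y y∈B φy≡s → only-x y (subst (λ i → NSet m r P Q i y) φy≡s (φ∈ y y∈B)))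

  noIsthmus⇒separated : NoIsthmus m r P Q → ∀ x → hP (suc (toℕ x)) ≤ hQ (toℕ x)
  noIsthmus⇒separated no-isthmus x = ≮⇒≥ λ pinched → no-isthmus x (pinched⇒isthmus x pinched)

  N′-confined : ∀ {j x u k} → N' m r P Q j x → u ≤ toℕ x → toℕ x ≤ k → FlatAt hP u → FlatAt hQ k →
                hP u ≤ toℕ j × toℕ j < hQ (suc k)
  N′-confined (inj₁ x∈Nj) u≤x x≤k _ _ =
    ≤-trans (P.mono u≤x) (proj₁ (nset⇒band x∈Nj)) , <-≤-trans (proj₂ (nset⇒band x∈Nj)) (Q.mono (s≤s x≤k))
  N′-confined {j} {x} {u} {k} (inj₂ (inj₁ (k′ , d , 0<d , j+d≡k′ , g , g-greatest , x≡g+d , x-greatest)))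
              u≤x x≤k P-flat _ = lower , upper
    where
    J = toℕ j
    G = toℕ g
    X = toℕ x
    g-north = greatest⇒northAtP g-greatest
    x-north = greatest⇒northAtP x-greatest
    upper : J < hQ (suc k)
    upper = begin-strict
      J               <⟨ subst (J <_) j+d≡k′ (subst (_≤ J + d) (+-comm J 1) (+-monoʳ-≤ J 0<d)) ⟩
      toℕ k′          <⟨ proj₂ (nset⇒band (proj₁ x-greatest)) ⟩
      hQ (suc X)      ≤⟨ Q.mono (s≤s x≤k) ⟩
      hQ (suc k)      ∎
      where open ≤-Reasoning
    lower : hP u ≤ J
    lower with u ≤? G
    ... | yes u≤g = ≤-trans (P.mono u≤g) (≤-reflexive (proj₁ g-north))
    ... | no  u≰g = contradiction run-broken (<-irrefl refl)
      where
      -- P climbs straight from g to x, so it cannot be flat at u in between.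
      run-broken : suc (J + d) < suc (J + d)
      run-broken = begin-strict
        suc (J + d)                ≡⟨ cong suc (trans j+d≡k′ (sym (proj₁ x-north))) ⟩
        suc (hP X)                 ≡⟨ sym (proj₂ x-north) ⟩
        hP (suc X)                 <⟨ P.flat⇒lipschitz< (≰⇒> u≰g) (s≤s u≤x) P-flat ⟩
        (suc X ∸ suc G) + hP (suc G) ≡⟨ cong₂ _+_ (trans (cong (_∸ G) x≡g+d) (m+n∸m≡n G d))
                                                  (trans (proj₂ g-north) (cong suc (proj₁ g-north))) ⟩
        d + suc J                  ≡⟨ trans (+-suc d J) (cong suc (+-comm d J)) ⟩
        suc (J + d)                ∎
        where open ≤-Reasoning
  N′-confined {j} {x} {u} {k} (inj₂ (inj₂ (k′ , d , 0<d , k′+d≡j , l , l-least , x+d≡l , x-least)))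
              u≤x x≤k _ Q-flat = lower , upper
    where
    J = toℕ j
    L = toℕ l
    X = toℕ x
    l-north = least⇒northAtQ l-least
    x-north = least⇒northAtQ x-least
    lower : hP u ≤ J
    lower = begin
      hP u    ≤⟨ P.mono u≤x ⟩
      hP X    ≤⟨ proj₁ (nset⇒band (proj₁ x-least)) ⟩
      toℕ k′  ≤⟨ subst (toℕ k′ ≤_) k′+d≡j (m≤m+n (toℕ k′) d) ⟩
      J       ∎
      where open ≤-Reasoning
    upper : J < hQ (suc k)
    upper with L ≤? k
    ... | yes l≤k = ≤-trans (≤-reflexive (sym (trans (proj₂ l-north) (cong suc (proj₁ l-north))))) (Q.mono (s≤s l≤k))
    ... | no  l≰k = contradiction run-broken (<-irrefl refl)
      where
      -- Q climbs straight from x to l, so it cannot be flat at k in between.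
      run-broken : suc (toℕ k′ + d) < suc (toℕ k′ + d)
      run-broken = begin-strict
        suc (toℕ k′ + d)           ≡⟨ cong suc (trans k′+d≡j (sym (proj₁ l-north))) ⟩
        suc (hQ L)                 ≡⟨ sym (proj₂ l-north) ⟩
        hQ (suc L)                 <⟨ Q.flat⇒lipschitz< x≤k (s≤s (<⇒≤ (≰⇒> l≰k))) Q-flat ⟩
        (suc L ∸ X) + hQ X         ≡⟨ cong₂ _+_ (trans (+-∸-assoc 1 (≤-trans x≤k (<⇒≤ (≰⇒> l≰k))))
                                                            (cong suc (trans (cong (_∸ X) (sym x+d≡l)) (m+n∸m≡n X d))))
                                                     (proj₁ x-north) ⟩
        suc d + toℕ k′             ≡⟨ cong suc (+-comm d (toℕ k′)) ⟩
        suc (toℕ k′ + d)           ∎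
        where open ≤-Reasoning

  module Greedy (T : Subset n) (φ : Fin n → Fin r)
                (φ∈ : ∀ x → x ∈ T → N' m r P Q (φ x) x)
                (φ-inj : ∀ x y → x ∈ T → y ∈ T → φ x ≡ φ y → x ≡ y) where

    mark : Fin n → ℕ
    mark x with x ∈? T
    ... | yes _ = 1
    ... | no  _ = 0

    marked : ℕ → ℕ
    marked a with a <? n
    ... | yes a<n = mark (fromℕ< a<n)
    ... | no  _   = 0

    marked-toℕ : ∀ x → marked (toℕ x) ≡ mark x
    marked-toℕ x with toℕ x <? n
    ... | yes x<n = cong mark (fromℕ<-toℕ x x<n)
    ... | no  x≮n = contradiction (toℕ<n x) x≮n

    marked≤1 : ∀ a → marked a ≤ 1
    marked≤1 a with a <? n
    ... | no _ = z≤n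
    ... | yes a<n with fromℕ< a<n ∈? T
    ...   | yes _ = ≤-refl
    ...   | no  _ = z≤n

    ∈⇒marked : ∀ {x} → x ∈ T → marked (toℕ x) ≡ 1
    ∈⇒marked {x} x∈T with x ∈? T | marked-toℕ x
    ... | yes _   | eq = eq
    ... | no  x∉T | _  = contradiction x∈T x∉T

    marked⇒∈ : ∀ x → marked (toℕ x) ≡ 1 → x ∈ T
    marked⇒∈ x eq with x ∈? T | marked-toℕ x
    ... | yes x∈T | _   = x∈T
    ... | no  _   | eq′ = contradiction (trans (sym eq′) eq) λ ()

    greedy : ℕ → ℕ
    greedy zero    = 0
    greedy (suc k) = (marked k + greedy k) ⊔ hP (suc k)

    hP≤greedy : ∀ k → hP k ≤ greedy k
    hP≤greedy zero    = ≤-reflexive (ht-zero P)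
    hP≤greedy (suc k) = m≤n⊔m _ _

    greedy-unit : UnitIncreasing greedy
    greedy-unit k = ≤-trans (m≤n+m (greedy k) (marked k)) (m≤m⊔n _ _) ,
                    ⊔-lub (+-monoˡ-≤ (greedy k) (marked≤1 k)) (≤-trans (P.step≤ k) (s≤s (hP≤greedy k)))

    lastTouch : ∀ k → ∃[ u ] (u ≤ k × greedy u ≡ hP u × (u ≡ k ⊎ FlatAt hP u) ×
                              (∀ a → u ≤ a → a < k → greedy (suc a) ≡ marked a + greedy a))
    lastTouch zero = 0 , z≤n , sym (ht-zero P) , inj₁ refl , λ _ _ ()
    lastTouch (suc k) with marked k + greedy k ≤? hP (suc k)
    ... | yes ≤hP = suc k , ≤-refl , m≤n⇒m⊔n≡n ≤hP , inj₁ refl ,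
                    λ a k+1≤a a<k+1 → contradiction (≤-trans a<k+1 k+1≤a) (<-irrefl refl)
    ... | no  ≰hP with lastTouch k
    ...   | u , u≤k , touch , last , window = u , m≤n⇒m≤1+n u≤k , touch , last′ last , window′
      where
      step : greedy (suc k) ≡ marked k + greedy k
      step = m≥n⇒m⊔n≡m (<⇒≤ (≰⇒> ≰hP))
      last′ : u ≡ k ⊎ FlatAt hP u → u ≡ suc k ⊎ FlatAt hP u
      last′ (inj₂ flat) = inj₂ flat
      last′ (inj₁ refl) with P.flat⊎rise u
      ... | inj₁ flat = inj₂ flat
      ... | inj₂ rise = contradiction (≤-trans (+-monoˡ-≤ (greedy u) (marked≤1 u))
                                                (≤-reflexive (trans (cong suc touch) (sym rise)))) ≰hP
      window′ : ∀ a → u ≤ a → a < suc k → greedy (suc a) ≡ marked a + greedy a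
      window′ a u≤a a<k+1 with m≤n⇒m<n∨m≡n (s≤s⁻¹ a<k+1)
      ... | inj₁ a<k  = window a u≤a a<k
      ... | inj₂ refl = step

    rise⇒∈ : ∀ {u k} → (∀ a → u ≤ a → a < k → greedy (suc a) ≡ marked a + greedy a) →
             ∀ x → u ≤ toℕ x → toℕ x < k → RiseAt greedy (toℕ x) → x ∈ T
    rise⇒∈ window x u≤x x<k rise =
      marked⇒∈ x (+-cancelʳ-≡ (greedy (toℕ x)) _ 1 (trans (sym (window (toℕ x) u≤x x<k)) rise))

    -- Pigeonhole: climbs after the last touch map injectively (by φ) into [hP u, hQ (k+1)).
    greedy≤hQ-at-flat : ∀ k → suc k ≤ n → FlatAt hQ k → greedy (suc k) ≤ hQ (suc k)
    greedy≤hQ-at-flat k k<n Q-flat with lastTouch (suc k)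
    ... | u , _ , touch , inj₁ refl , _ = ≤-trans (≤-reflexive touch) (P≤Q u)
    ... | u , u≤k+1 , touch , inj₂ P-flat , window = begin
      greedy (suc k)                           ≤⟨ m≤n+m∸n (greedy (suc k)) (greedy u) ⟩
      greedy u + (greedy (suc k) ∸ greedy u)    ≤⟨ +-mono-≤ (≤-reflexive touch) climbs ⟩
      hP u + (hQ (suc k) ∸ hP u)               ≡⟨ m+[n∸m]≡n (≤-trans (P≤Q u) (Q.mono u≤k+1)) ⟩
      hQ (suc k)                               ∎
      where
      open ≤-Reasoning
      enum = UnitStep.enumerate-rises greedy-unit u (suc k) u≤k+1 k<n
      e = proj₁ enum
      e∈T : ∀ j → e j ∈ T
      e∈T j = let u≤ej , ej<k+1 , rise = proj₂ (proj₂ enum) j in rise⇒∈ window (e j) u≤ej ej<k+1 rise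
      climbs : greedy (suc k) ∸ greedy u ≤ hQ (suc k) ∸ hP u
      climbs = injectiveOn-interval-size φ φ-inj e (proj₁ (proj₂ enum)) e∈T λ j →
        let u≤ej , ej<k+1 , _ = proj₂ (proj₂ enum) j
        in N′-confined (φ∈ (e j) (e∈T j)) u≤ej (s≤s⁻¹ ej<k+1) P-flat Q-flat

    greedy≤hQ : ∀ k → k ≤ n → greedy k ≤ hQ k
    greedy≤hQ zero    _   = z≤n
    greedy≤hQ (suc k) k<n with Q.flat⊎rise k
    ... | inj₁ flat = greedy≤hQ-at-flat k k<n flat
    ... | inj₂ rise = ⊔-lub (≤-trans (+-mono-≤ (marked≤1 k) (greedy≤hQ k (<⇒≤ k<n))) (≤-reflexive (sym rise)))
                            (P≤Q (suc k))

    path : Σ (Vec Step n) λ R → Between R × (∀ k → k ≤ n → ht R k ≡ greedy k)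
    path = path-from-heights greedy-unit (λ k k≤n → hP≤greedy k , greedy≤hQ k k≤n)

    T-north : ∀ x → x ∈ T → lookup (proj₁ path) x ≡ N
    T-north x x∈T = rise⇒north R x (begin
      ht R (suc X)          ≡⟨ ht-R (suc X) (toℕ<n x) ⟩
      greedy (suc X)        ≡⟨ ≤-antisym (UnitStep.step≤ greedy-unit X)
                                         (≤-trans (≤-reflexive (cong (_+ greedy X) (sym (∈⇒marked x∈T)))) (m≤m⊔n _ _)) ⟩
      suc (greedy X)        ≡⟨ cong suc (sym (ht-R X (<⇒≤ (toℕ<n x)))) ⟩
      suc (ht R X)          ∎)
      where
      open ≡-Reasoning
      R = proj₁ path
      ht-R = proj₂ (proj₂ path)
      X = toℕ x

    partialTransversal : PartialTransversal (NSet m r P Q) T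
    partialTransversal = northSteps-partialTransversal (proj₁ path) (proj₁ (proj₂ path)) φ T T-north

  N⊆N′ : ∀ i x → NSet m r P Q i x → N' m r P Q i x
  N⊆N′ _ _ = inj₁

  N′⇒N-partialTransversal : ∀ T → PartialTransversal (N' m r P Q) T → PartialTransversal (NSet m r P Q) T
  N′⇒N-partialTransversal T (φ , φ∈ , φ-inj) = Greedy.partialTransversal T φ φ∈ φ-inj

  N⇒N′-partialTransversal : ∀ T → PartialTransversal (NSet m r P Q) T → PartialTransversal (N' m r P Q) T
  N⇒N′-partialTransversal _ = Transversals.partialTransversal-mono (NSet m r P Q) (N' m r P Q) N⊆N′

  N′-presentation : IsPresentation m r P Q (N' m r P Q)
  N′-presentation T =
    Transversals.maxPartialTransversal-transfer (N' m r P Q) (NSet m r P Q)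
      N′⇒N-partialTransversal N⇒N′-partialTransversal ,
    Transversals.maxPartialTransversal-transfer (NSet m r P Q) (N' m r P Q)
      N⇒N′-partialTransversal N′⇒N-partialTransversal

  module Maximality (no-isthmus : NoIsthmus m r P Q) (A′ : Fin r → Subset n)
                    (A′-presentation : IsPresentation m r P Q (toFamily A′))
                    (N′⊆A′ : ∀ i x → N' m r P Q i x → x ∈ A′ i)
                    (i : Fin r) (x : Fin n) (x∈A′ : x ∈ A′ i) where

    I X : ℕ
    I = toℕ i
    X = toℕ x

    -- Swapping the I-th North step of a path R that is flat at x for x gives a partial transversal
    -- of A′. Extended to a basis, it would put hi - lo + 1 elements of a window [u, K) on the
    -- hi - lo indices [lo, hi) if R climbs hi - lo times in the window.
    module Exchange (R : Vec Step n) (R-between : Between R) (R-flat : FlatAt (ht R) X) where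

      R-path : IsPath m r R
      R-path = proj₁ R-between

      Kept : Fin n → Set
      Kept y = lookup R y ≡ N × ht R (toℕ y) ≢ I

      kept? : ∀ y → Dec (Kept y)
      kept? y = north? (lookup R y) ×-dec ¬? (ht R (toℕ y) ≟ I)

      exchanged : PartialTransversal (toFamily A′) (select kept? ∪ ⁅ x ⁆)
      exchanged = Transversals.∪⁅⁆-partialTransversal (toFamily A′) (heightIndex R (λ _ → i))
        (λ y y∈ → N′⊆A′ _ y (inj₁ (heightIndex-nset R R-between _ y (proj₁ (∈-select⁻ kept? y∈)))))
        (λ y z y∈ z∈ → heightIndex-injective R R-path _ y z
                         (proj₁ (∈-select⁻ kept? y∈)) (proj₁ (∈-select⁻ kept? z∈)))
        x∈A′
        λ y y∈ index≡i → contradiction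
          (trans (sym (toℕ-heightIndex R R-path _ y (proj₁ (∈-select⁻ kept? y∈)))) (cong toℕ index≡i))
          (proj₂ (∈-select⁻ kept? y∈))

      window-contradiction : ∀ {u K lo hi} → u ≤ X → X < K → K ≤ n → I < lo ⊎ hi ≤ I →
        (∀ y j → u ≤ toℕ y → toℕ y < K → NSet m r P Q j y → lo ≤ toℕ j × toℕ j < hi) →
        ht R K ≡ ht R u + (hi ∸ lo) → ⊥
      window-contradiction {u} {K} {lo} {hi} u≤X X<K K≤n I∉ confined full =
        Transversals.¬¬-maximalExtension (toFamily A′) exchanged too-many
        where
        enum = UnitStep.enumerate-rises (ht-unitIncreasing R) u K (≤-trans u≤X (<⇒≤ X<K)) K≤n
        e = proj₁ enum
        e-window = proj₂ (proj₂ enum)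
        e-north : ∀ j → lookup R (e j) ≡ N
        e-north j = rise⇒north R (e j) (proj₂ (proj₂ (e-window j)))
        e-confined : ∀ j → lo ≤ ht R (toℕ (e j)) × ht R (toℕ (e j)) < hi
        e-confined j = let u≤ej , ej<K , _ = e-window j
                           index = heightIndex R (λ _ → i) (e j)
                       in subst (λ h → lo ≤ h × h < hi) (toℕ-heightIndex R R-path _ (e j) (e-north j))
                            (confined (e j) index u≤ej ej<K (heightIndex-nset R R-between _ (e j) (e-north j)))
        e-kept : ∀ j → Kept (e j)
        e-kept j = e-north j , λ ht≡I → [ (λ I<lo → <-irrefl (sym ht≡I) (<-≤-trans I<lo (proj₁ (e-confined j))))
                                        , (λ hi≤I → <-irrefl ht≡I (<-≤-trans (proj₂ (e-confined j)) hi≤I)) ] I∉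
        points : Fin (suc (ht R K ∸ ht R u)) → Fin n
        points zero    = x
        points (suc j) = e j
        x≢e : ∀ j → x ≢ e j
        x≢e j x≡ej = UnitStep.rise⇒¬flat (ht-unitIncreasing R) (proj₂ (proj₂ (e-window j)))
                                       (subst (FlatAt (ht R) ∘ toℕ) x≡ej R-flat)
        points-injective : Injective _≡_ _≡_ points
        points-injective {zero}  {zero}   _  = refl
        points-injective {zero}  {suc j}  eq = contradiction eq (x≢e j)
        points-injective {suc j} {zero}   eq = contradiction (sym eq) (x≢e j)
        points-injective {suc j} {suc j′} eq = cong suc (proj₁ (proj₂ enum) eq)
        too-many : ∃[ B ] (MaxPartialTransversal (toFamily A′) B × select kept? ∪ ⁅ x ⁆ ⊆ B) → ⊥
        too-many (B , B-max , exchanged⊆B) = 1+n≰n (begin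
          suc (hi ∸ lo)                  ≡⟨ cong suc (sym (trans (cong (_∸ ht R u) full) (m+n∸m≡n (ht R u) (hi ∸ lo)))) ⟩
          suc (ht R K ∸ ht R u)          ≤⟨ injectiveOn-interval-size φB φB-inj points points-injective points∈B
                                              (λ j → confined (points j) (φB (points j)) (proj₁ (points-window j))
                                                              (proj₂ (points-window j)) (φB∈ (points j) (points∈B j))) ⟩
          hi ∸ lo                        ∎)
          where
          open ≤-Reasoning
          B-transversal = proj₁ (proj₁ (A′-presentation B) B-max)
          φB = proj₁ B-transversal
          φB∈ = proj₁ (proj₂ B-transversal)
          φB-inj = proj₂ (proj₂ B-transversal)
          points∈B : ∀ j → points j ∈ B
          points∈B zero    = exchanged⊆B (x∈p∪q⁺ (inj₂ (x∈⁅x⁆ x)))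
          points∈B (suc j) = exchanged⊆B (x∈p∪q⁺ (inj₁ (∈-select⁺ kept? (e-kept j))))
          points-window : ∀ j → u ≤ toℕ (points j) × toℕ (points j) < K
          points-window zero    = u≤X , X<K
          points-window (suc j) = proj₁ (e-window j) , proj₁ (proj₂ (e-window j))

    separated : hP (suc X) ≤ hQ X
    separated = noIsthmus⇒separated no-isthmus x

    -- P takes its i-th North step at G < x. Either P climbs straight from G to x (so x ∈ I⁺_i),
    -- or P can be pushed to a path that is flat at x and still takes its i-th North step at G.
    module RightOfBand {G} (G<n : G < n) (G-north : NorthAt hP I G) (G<X : G < X) where

      hP[G+1]≡I+1 : hP (suc G) ≡ suc I
      hP[G+1]≡I+1 = trans (proj₂ G-north) (cong suc (proj₁ G-north))

      ℓ : ℕ → ℕ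
      ℓ = line (suc I) (suc G)

      hP≤ℓ : ∀ {k} → suc G ≤ k → hP k ≤ ℓ k
      hP≤ℓ {k} G<k = ≤-trans (P.lipschitz G<k)
                             (≤-reflexive (trans (cong ((k ∸ suc G) +_) hP[G+1]≡I+1) (+-comm (k ∸ suc G) (suc I))))

      straight-climb⇒I⁺ : hP (suc X) ≡ ℓ (suc X) → IPlus m r P Q i x
      straight-climb⇒I⁺ climbs = k , X ∸ G , m<n⇒0<n∸m G<X , I+d≡k , g , g-greatest , X≡g+d , x-greatest
        where
        x-north : NorthAt hP (ℓ X) X
        x-north = P.squeeze (hP≤ℓ G<X) (≤-reflexive (sym (trans climbs (line-rises (suc I) (suc G) G<X))))
        ℓX<r : ℓ X < r
        ℓX<r = ≤-trans (≤-reflexive (sym (trans (proj₂ x-north) (cong suc (proj₁ x-north))))) (path-ht≤r P P-path _)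
        k = fromℕ< ℓX<r
        I+d≡k : I + (X ∸ G) ≡ toℕ k
        I+d≡k = begin
          I + (X ∸ G)           ≡⟨ cong (I +_) (+-∸-assoc 1 G<X) ⟩
          I + suc (X ∸ suc G)   ≡⟨ +-suc I (X ∸ suc G) ⟩
          ℓ X                   ≡⟨ sym (toℕ-fromℕ< ℓX<r) ⟩
          toℕ k                 ∎
          where open ≡-Reasoning
        g = fromℕ< G<n
        g-greatest = northAtP⇒greatest (subst (NorthAt hP I) (sym (toℕ-fromℕ< G<n)) G-north)
        X≡g+d : X ≡ toℕ g + (X ∸ G)
        X≡g+d = trans (sym (m+[n∸m]≡n (<⇒≤ G<X))) (cong (_+ (X ∸ G)) (sym (toℕ-fromℕ< G<n)))
        x-greatest = northAtP⇒greatest (subst (λ c → NorthAt hP c X) (sym (toℕ-fromℕ< ℓX<r)) x-north)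

      detour-contradiction : hP (suc X) ≢ ℓ (suc X) → ⊥
      detour-contradiction ¬climbs =
        Exchange.window-contradiction R R-between R-flat G<X (toℕ<n x) ≤-refl (inj₁ ≤-refl) confined full
        where
        s = hP (suc X)
        s≤ℓX : s ≤ ℓ X
        s≤ℓX = s≤s⁻¹ (≤-trans (≤∧≢⇒< (hP≤ℓ (s≤s (<⇒≤ G<X))) ¬climbs)
                              (≤-reflexive (line-rises (suc I) (suc G) G<X)))
        ℓ-unit = line-unitIncreasing (suc I) (suc G)
        D = λ k → ℓ k ⊓ s
        detour = clamp-path (⊓-unitIncreasing ℓ-unit (const-unitIncreasing s))
        R = proj₁ detour
        R-between = proj₁ (proj₂ detour)
        ht-R = proj₂ (proj₂ detour)
        R-flat : FlatAt (ht R) X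
        R-flat = begin
          ht R (suc X)    ≡⟨ ht-R (suc X) (toℕ<n x) ⟩
          clamp D (suc X) ≡⟨ clamp-fixes D (m≥n⇒m⊓n≡n (≤-trans s≤ℓX (UnitStep.step≥ ℓ-unit X)))
                                         ≤-refl (≤-trans separated (Q.step≥ X)) ⟩
          s               ≡⟨ sym (clamp-fixes D (m≥n⇒m⊓n≡n s≤ℓX) (P.step≥ X) separated) ⟩
          clamp D X       ≡⟨ sym (ht-R X (<⇒≤ (toℕ<n x))) ⟩
          ht R X          ∎
          where open ≡-Reasoning
        confined : ∀ y j → suc G ≤ toℕ y → toℕ y < n → NSet m r P Q j y → suc I ≤ toℕ j × toℕ j < r
        confined y j G<y _ y∈Nj =
          ≤-trans (≤-reflexive (sym hP[G+1]≡I+1)) (≤-trans (P.mono G<y) (proj₁ (nset⇒band y∈Nj))) , toℕ<n j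
        ht-R[G+1] : ht R (suc G) ≡ suc I
        ht-R[G+1] = trans (ht-R (suc G) G<n)
          (trans (clamp-below D (≤-trans (m⊓n≤m _ _)
                                         (≤-reflexive (trans (line-start (suc I) (suc G)) (sym hP[G+1]≡I+1)))))
                 hP[G+1]≡I+1)
        full : ht R n ≡ ht R (suc G) + (r ∸ suc I)
        full = begin
          ht R n                     ≡⟨ proj₁ R-between ⟩
          r                          ≡⟨ sym (m+[n∸m]≡n (toℕ<n i)) ⟩
          suc I + (r ∸ suc I)        ≡⟨ cong (_+ (r ∸ suc I)) (sym ht-R[G+1]) ⟩
          ht R (suc G) + (r ∸ suc I) ∎
          where open ≡-Reasoning

    right-of-band : I < hP X → N' m r P Q i x
    right-of-band I<hPX with northAt-exists P P-path i
    ... | G , G<n , G-north = climbs-or-detours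
      where
      G<X : G < X
      G<X = ≰⇒> λ X≤G → <-irrefl refl (<-≤-trans I<hPX (≤-trans (P.mono X≤G) (≤-reflexive (proj₁ G-north))))
      open RightOfBand G<n G-north G<X
      climbs-or-detours : N' m r P Q i x
      climbs-or-detours with hP (suc X) ≟ ℓ (suc X)
      ... | yes climbs = inj₂ (inj₁ (straight-climb⇒I⁺ climbs))
      ... | no ¬climbs = ⊥-elim (detour-contradiction ¬climbs)

    -- Q takes its i-th North step at L > x. Either Q climbs straight from x to L (so x ∈ I⁻_i),
    -- or Q can be pushed to a path that is flat at x and still takes its i-th North step at L.
    module LeftOfBand {L} (L<n : L < n) (L-north : NorthAt hQ I L) (X<L : X < L) where

      s : ℕ
      s = hQ X

      straight-climb⇒I⁻ : hQ (suc X) ≤ I → s + (L ∸ X) ≡ I → IMinus m r P Q i x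
      straight-climb⇒I⁻ hQ[X+1]≤I climbs = k , L ∸ X , m<n⇒0<n∸m X<L , k+d≡I , l , l-least , X+d≡l , x-least
        where
        x-rise : RiseAt hQ X
        x-rise with Q.flat⊎rise X
        ... | inj₂ rise = rise
        ... | inj₁ flat = contradiction (begin
          suc I              ≡⟨ cong suc (sym (proj₁ L-north)) ⟩
          suc (hQ L)         ≤⟨ Q.flat⇒lipschitz< ≤-refl X<L flat ⟩
          (L ∸ X) + s        ≡⟨ +-comm (L ∸ X) s ⟩
          s + (L ∸ X)        ≡⟨ climbs ⟩
          I                  ∎) 1+n≰n
          where open ≤-Reasoning
        s<r : s < r
        s<r = ≤-trans (≤-reflexive (sym x-rise)) (≤-trans hQ[X+1]≤I (<⇒≤ (toℕ<n i)))
        k = fromℕ< s<r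
        k+d≡I : toℕ k + (L ∸ X) ≡ I
        k+d≡I = trans (cong (_+ (L ∸ X)) (toℕ-fromℕ< s<r)) climbs
        l = fromℕ< L<n
        l-least = northAtQ⇒least (subst (NorthAt hQ I) (sym (toℕ-fromℕ< L<n)) L-north)
        X+d≡l : X + (L ∸ X) ≡ toℕ l
        X+d≡l = trans (m+[n∸m]≡n (<⇒≤ X<L)) (sym (toℕ-fromℕ< L<n))
        x-least = northAtQ⇒least (sym (toℕ-fromℕ< s<r) , x-rise)

      detour-contradiction : s + (L ∸ X) ≢ I → ⊥
      detour-contradiction ¬climbs =
        Exchange.window-contradiction R R-between R-flat z≤n X<L (<⇒≤ L<n) (inj₂ ≤-refl) confined full
        where
        I≤s+d′ : I ≤ s + (L ∸ suc X)
        I≤s+d′ = s≤s⁻¹ (≤∧≢⇒< (begin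
          I                            ≡⟨ sym (proj₁ L-north) ⟩
          hQ L                         ≤⟨ Q.lipschitz X<L ⟩
          (L ∸ suc X) + hQ (suc X)     ≤⟨ +-monoʳ-≤ (L ∸ suc X) (Q.step≤ X) ⟩
          (L ∸ suc X) + suc s          ≡⟨ +-suc (L ∸ suc X) s ⟩
          suc ((L ∸ suc X) + s)        ≡⟨ cong suc (+-comm (L ∸ suc X) s) ⟩
          suc (s + (L ∸ suc X))        ∎)
          λ eq → ¬climbs (trans (trans (cong (s +_) (+-∸-assoc 1 X<L)) (+-suc s (L ∸ suc X))) (sym eq)))
          where open ≤-Reasoning
        D = line s (suc X)
        detour = clamp-path (line-unitIncreasing s (suc X))
        R = proj₁ detour
        R-between = proj₁ (proj₂ detour)
        ht-R = proj₂ (proj₂ detour)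
        R-flat : FlatAt (ht R) X
        R-flat = begin
          ht R (suc X)    ≡⟨ ht-R (suc X) (toℕ<n x) ⟩
          clamp D (suc X) ≡⟨ clamp-fixes D (line-start s (suc X)) separated (Q.step≥ X) ⟩
          s               ≡⟨ sym (clamp-fixes D (trans (cong (s +_) (m≤n⇒m∸n≡0 (n≤1+n X))) (+-identityʳ s))
                                                (≤-trans (P.step≥ X) separated) ≤-refl) ⟩
          clamp D X       ≡⟨ sym (ht-R X (<⇒≤ (toℕ<n x))) ⟩
          ht R X          ∎
          where open ≡-Reasoning
        confined : ∀ y j → 0 ≤ toℕ y → toℕ y < L → NSet m r P Q j y → 0 ≤ toℕ j × toℕ j < I
        confined y j _ y<L y∈Nj =
          z≤n , <-≤-trans (proj₂ (nset⇒band y∈Nj)) (≤-trans (Q.mono y<L) (≤-reflexive (proj₁ L-north)))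
        full : ht R L ≡ ht R 0 + (I ∸ 0)
        full = begin
          ht R L           ≡⟨ ht-R L (<⇒≤ L<n) ⟩
          clamp D L        ≡⟨ clamp-above D (≤-trans (≤-reflexive (proj₁ L-north)) I≤s+d′) ⟩
          hQ L             ≡⟨ proj₁ L-north ⟩
          I                ≡⟨ cong (_+ I) (sym (ht-zero R)) ⟩
          ht R 0 + (I ∸ 0) ∎
          where open ≡-Reasoning

    left-of-band : hQ (suc X) ≤ I → N' m r P Q i x
    left-of-band hQ[X+1]≤I with northAt-exists Q Q-path i
    ... | L , L<n , L-north = climbs-or-detours
      where
      X<L : X < L
      X<L = ≰⇒> λ L≤X → 1+n≰n (≤-trans (≤-reflexive (sym (trans (proj₂ L-north) (cong suc (proj₁ L-north)))))
                                        (≤-trans (Q.mono (s≤s L≤X)) hQ[X+1]≤I))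
      open LeftOfBand L<n L-north X<L
      climbs-or-detours : N' m r P Q i x
      climbs-or-detours with s + (L ∸ X) ≟ I
      ... | yes climbs = inj₂ (inj₂ (straight-climb⇒I⁻ hQ[X+1]≤I climbs))
      ... | no ¬climbs = ⊥-elim (detour-contradiction ¬climbs)

    N′-membership : N' m r P Q i x
    N′-membership with hP X ≤? I | I <? hQ (suc X)
    ... | yes hPX≤I | yes I<hQ = inj₁ (band⇒nset hPX≤I I<hQ)
    ... | no  hPX≰I | _        = right-of-band (≰⇒> hPX≰I)
    ... | yes _     | no  I≮hQ = left-of-band (≮⇒≥ I≮hQ)

theorem6p4 : (m r : ℕ) (P Q : Vec Step (m + r)) →
    IsPath m r P → IsPath m r Q → NotAbove P Q →
    NoIsthmus m r P Q →
    IsMaximalPresentation m r P Q (N' m r P Q)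
theorem6p4 m r P Q P-path Q-path P≤Q no-isthmus =
  N′-presentation ,
  λ A′ A′-presentation N′⊆A′ → Maximality.N′-membership no-isthmus A′ A′-presentation N′⊆A′
  where open LatticePathMatroid m r P Q P-path Q-path P≤Q
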